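{- For $p=021$: $\sum_{n\geq 0}|\mathcal{C}_n(p)|x^n=\frac{1-4x+5x^2-x^3}{(1-2x)^2(1-x)}$, and $|\mathcal{C}_n(p)|=(n-1)\cdot 2^{n-2}+1$ for all $n\geq 1$. Moreover, for all $n\geq 2$ the popularity of descents $\sum_{w\in\mathcal{C}_n(p)}d(w)$ equals $(n+1)(n-2)\cdot 2^{n-5}$, and $\sum_{n\geq 0}\big(\sum_{w\in\mathcal{C}_n(p)}d(w)\big)x^n=\frac{x^3(1-x)}{(1-2x)^3}$.
   Context: A Catalan word of length $n\geq 1$ is a word $w_1\ldots w_n$ over the non-negative integers with $w_1=0$ and $0\leq w_i\leq w_{i-1}+1$ for $2\leq i\leq n$; the empty word is the unique Catalan word of length $0$. A word $w$ contains the pattern $p=p_1\ldots p_k$ if there are indices $i_1<\cdots<i_k$ such that $w_{i_1}\ldots w_{i_k}$ is order-isomorphic to $p$ (for all $a,b$: $w_{i_a}<w_{i_b}$ iff $p_a<p_b$, and $w_{i_a}=w_{i_b}$ iff $p_a=p_b$); otherwise $w$ avoids $p$. $\mathcal{C}_n(p)$ is the set of Catalan words of length $n$ avoiding $p$. A descent of $w$ is an index $i$ with $w_i>w_{i+1}$; $d(w)$ denotes the number of descents of $w$. -}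

module Defs where

open import Data.Nat using (ℕ; zero; suc; _<_; _≤_; _<ᵇ_)
open import Data.Bool using (if_then_else_)
open import Data.Integer as ℤ using (ℤ; +_)
open import Data.List using (List; []; _∷_; length; lookup; map)
open import Data.List.Relation.Binary.Sublist.Propositional using (_⊆_)
open import Data.List.Relation.Unary.Unique.Propositional using (Unique)
open import Data.List.Membership.Propositional using (_∈_)
open import Data.Fin using (Fin; cast)
open import Data.Product using (Σ; ∃; _×_)
open import Data.Unit using (⊤)
open import Relation.Binary.PropositionalEquality using (_≡_)
open import Relation.Nullary using (¬_)
open import Function.Bundles using (_⇔_)

StepsFrom : ℕ → List ℕ → Set
StepsFrom prev [] = ⊤
StepsFrom prev (y ∷ ys) = (y ≤ suc prev) × StepsFrom y ys

IsCatalan : List ℕ → Set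
IsCatalan [] = ⊤
IsCatalan (x ∷ xs) = (x ≡ 0) × StepsFrom x xs

CatalanWord : ℕ → List ℕ → Set
CatalanWord n w = (length w ≡ n) × IsCatalan w

OrderIso : List ℕ → List ℕ → Set
OrderIso u p = Σ (length u ≡ length p) λ eq → ∀ (a b : Fin (length u)) →
  ((lookup u a < lookup u b) ⇔ (lookup p (cast eq a) < lookup p (cast eq b))) ×
  ((lookup u a ≡ lookup u b) ⇔ (lookup p (cast eq a) ≡ lookup p (cast eq b)))

Contains : List ℕ → List ℕ → Set
Contains w p = ∃ λ u → (u ⊆ w) × OrderIso u p

Avoids : List ℕ → List ℕ → Set
Avoids w p = ¬ Contains w p

des : List ℕ → ℕ
des [] = 0
des (x ∷ []) = 0
des (x ∷ y ∷ ys) = (if y <ᵇ x then 1 else 0) Data.Nat.+ des (y ∷ ys)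

p021 : List ℕ
p021 = 0 ∷ 2 ∷ 1 ∷ []

Enumerates : List ℕ → ℕ → List (List ℕ) → Set
Enumerates p n L = Unique L × (∀ w → (w ∈ L) ⇔ (CatalanWord n w × Avoids w p))

-- formal power series with integer coefficients: ℕ → ℤ; polynomials: List ℤ
polyCoeff : List ℤ → ℕ → ℤ
polyCoeff [] _ = + 0
polyCoeff (c ∷ cs) zero = c
polyCoeff (c ∷ cs) (suc n) = polyCoeff cs n

-- product of a polynomial and a power series
-- (c₀ + x·P) · A : coefficient n = c₀ A n + (P·A) (n-1)
mulPS : List ℤ → (ℕ → ℤ) → ℕ → ℤ
mulPS [] A n = + 0
mulPS (c ∷ cs) A zero = c ℤ.* A zero
mulPS (c ∷ cs) A (suc n) = (c ℤ.* A (suc n)) ℤ.+ mulPS cs A n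

polyMul : List ℤ → List ℤ → List ℤ
polyMul [] q = []
polyMul (c ∷ cs) q = addP (map (c ℤ.*_) q) (+ 0 ∷ polyMul cs q)
  where
  addP : List ℤ → List ℤ → List ℤ
  addP [] ys = ys
  addP (x ∷ xs) [] = x ∷ xs
  addP (x ∷ xs) (y ∷ ys) = (x ℤ.+ y) ∷ addP xs ys

one-2x : List ℤ
one-2x = + 1 ∷ ℤ.- (+ 2) ∷ []

one-x : List ℤ
one-x = + 1 ∷ ℤ.- (+ 1) ∷ []

-- A Catalan word 0w avoids 021 exactly when no positive letter of w is smaller than an
-- earlier letter, i.e. every letter of w is 0 or a weak left-to-right maximum.  Such words
-- are generated letter by letter from the state (previous letter, maximum so far): after a
-- 0 below a maximum t ≥ 2 only zeros can follow, after the maximum t ≥ 2 itself the next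
-- letter is 0, t or t + 1, and the states (0,1), (1,1) feed into each other and into (2,2).
-- Solving the resulting linear recurrences for the number of words and for their descents
-- gives the closed forms, and these satisfy the recurrences with characteristic polynomials
-- (1 - 2x)²(1 - x) and (1 - 2x)³, which is what the generating-function identities say.
module Submission where

open import Defs
open import Data.Nat using (ℕ; zero; suc; _+_; _*_; _∸_; _^_; _≤_; _<_; _⊔_; _<ᵇ_; z≤n; s≤s)
open import Data.Nat.Properties
open import Data.Nat.ListAction using (sum)
open import Data.Nat.ListAction.Properties using (sum-++; sum-↭)
open import Data.Nat.Tactic.RingSolver using (solve-∀)
open import Data.Integer as ℤ using (ℤ; +_)
open import Data.Integer.Properties using (pos-+; pos-*; +-inverseʳ)
import Data.Integer.Tactic.RingSolver as ℤ-Solver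
open import Data.Bool using (true; false; if_then_else_; T)
open import Data.Fin using (Fin; cast) renaming (zero to #0; suc to fsuc)
open import Data.List using (List; []; _∷_; length; lookup; map; _++_; applyUpTo; concatMap)
open import Data.List.Properties using (length-++; length-map; map-++; map-∘; ∷-injectiveʳ)
open import Data.List.Relation.Unary.Any as Any using (Any; here; there)
open import Data.List.Relation.Unary.Any.Properties using (Any-⊎⁻)
open import Data.List.Relation.Unary.All using ([]; _∷_)
import Data.List.Relation.Unary.All as All
open import Data.List.Relation.Unary.All.Properties using (All¬⇒¬Any)
open import Data.List.Relation.Unary.Unique.Propositional using (Unique; []; _∷_)
import Data.List.Relation.Unary.Unique.Propositional.Properties as Unique
open import Data.List.Relation.Binary.Disjoint.Propositional using (Disjoint)
open import Data.List.Membership.Propositional using (_∈_; find; lose)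
open import Data.List.Membership.Propositional.Properties
  using (∈-map⁺; ∈-map⁻; ∈-applyUpTo⁺; ∈-applyUpTo⁻; ∈-concatMap⁺; ∈-concatMap⁻)
open import Data.List.Membership.Propositional.Properties.WithK using (unique∧set⇒bag)
open import Data.List.Relation.Binary.Sublist.Propositional using (_⊆_; _∷_; _∷ʳ_; from∈; to∈)
open import Data.List.Relation.Binary.Sublist.Propositional.Properties using (∷ˡ⁻)
open import Data.List.Relation.Binary.Permutation.Propositional using (_↭_)
open import Data.List.Relation.Binary.Permutation.Propositional.Properties using (↭-length; map⁺)
open import Data.List.Relation.Binary.BagAndSetEquality using (∼bag⇒↭)
open import Data.Product using (∃; ∃₂; _×_; _,_; proj₁; proj₂)
open import Data.Sum using (_⊎_; inj₁; inj₂)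
open import Data.Unit using (⊤; tt)
open import Data.Empty using (⊥; ⊥-elim)
open import Relation.Nullary using (¬_; yes; no; contradiction)
open import Relation.Binary using (tri<; tri≈; tri>)
open import Relation.Binary.PropositionalEquality
open import Function using (_∘_)
open import Function.Bundles using (_⇔_; mk⇔; Equivalence)
import Function.Properties.Equivalence as ⇔

-- Avoiding 021

PositiveBelow : ℕ → ℕ → Set
PositiveBelow b c = 0 < c × c < b

PositiveInversion : List ℕ → Set
PositiveInversion [] = ⊥
PositiveInversion (b ∷ w) = Any (PositiveBelow b) w ⊎ PositiveInversion w

ZeroOrRecord : ℕ → List ℕ → Set
ZeroOrRecord m [] = ⊤
ZeroOrRecord m (y ∷ ys) = (y ≡ 0 ⊎ m ≤ y) × ZeroOrRecord (m ⊔ y) ys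

positiveBelow-mono : ∀ {b b′ c} → b ≤ b′ → PositiveBelow b c → PositiveBelow b′ c
positiveBelow-mono b≤b′ (0<c , c<b) = 0<c , <-≤-trans c<b b≤b′

positiveBelow-⊔⁻ : ∀ m y {c} → PositiveBelow (m ⊔ y) c → PositiveBelow m c ⊎ PositiveBelow y c
positiveBelow-⊔⁻ m y p with ⊔-sel m y
... | inj₁ m⊔y≡m = inj₁ (subst (λ b → PositiveBelow b _) m⊔y≡m p)
... | inj₂ m⊔y≡y = inj₂ (subst (λ b → PositiveBelow b _) m⊔y≡y p)

zeroOrAtLeast⇒¬positiveBelow : ∀ {m y} → y ≡ 0 ⊎ m ≤ y → ¬ PositiveBelow m y
zeroOrAtLeast⇒¬positiveBelow (inj₁ refl) ()
zeroOrAtLeast⇒¬positiveBelow (inj₂ m≤y) (_ , y<m) = <⇒≱ y<m m≤y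

¬positiveBelow⇒zeroOrAtLeast : ∀ m y → ¬ PositiveBelow m y → y ≡ 0 ⊎ m ≤ y
¬positiveBelow⇒zeroOrAtLeast m zero _ = inj₁ refl
¬positiveBelow⇒zeroOrAtLeast m (suc y) ¬below with m ≤? suc y
... | yes m≤y = inj₂ m≤y
... | no m≰y = contradiction (s≤s z≤n , ≰⇒> m≰y) ¬below

zeroOrRecord⇒¬positiveInversion : ∀ m w → ZeroOrRecord m w → ¬ PositiveInversion (m ∷ w)
zeroOrRecord⇒¬positiveInversion m [] _ (inj₁ ())
zeroOrRecord⇒¬positiveInversion m [] _ (inj₂ ())
zeroOrRecord⇒¬positiveInversion m (y ∷ ys) (zeroOrAtLeast , rest) = λ where
    (inj₁ (here below)) → zeroOrAtLeast⇒¬positiveBelow zeroOrAtLeast below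
    (inj₁ (there below-m)) → ih (inj₁ (Any.map (positiveBelow-mono (m≤m⊔n m y)) below-m))
    (inj₂ (inj₁ below-y)) → ih (inj₁ (Any.map (positiveBelow-mono (m≤n⊔m m y)) below-y))
    (inj₂ (inj₂ inv)) → ih (inj₂ inv)
  where
  ih : ¬ PositiveInversion ((m ⊔ y) ∷ ys)
  ih = zeroOrRecord⇒¬positiveInversion (m ⊔ y) ys rest

¬positiveInversion⇒zeroOrRecord : ∀ m w → ¬ PositiveInversion (m ∷ w) → ZeroOrRecord m w
¬positiveInversion⇒zeroOrRecord m [] _ = tt
¬positiveInversion⇒zeroOrRecord m (y ∷ ys) ¬inv =
  ¬positiveBelow⇒zeroOrAtLeast m y (¬inv ∘ inj₁ ∘ here) ,
  ¬positiveInversion⇒zeroOrRecord (m ⊔ y) ys ¬inv′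
  where
  ¬inv′ : ¬ PositiveInversion ((m ⊔ y) ∷ ys)
  ¬inv′ (inj₁ below) with Any-⊎⁻ (Any.map (positiveBelow-⊔⁻ m y) below)
  ... | inj₁ below-m = ¬inv (inj₁ (there below-m))
  ... | inj₂ below-y = ¬inv (inj₂ (inj₁ below-y))
  ¬inv′ (inj₂ inv) = ¬inv (inj₂ (inj₂ inv))

positiveInversion⁺ : ∀ {b c w} → (b ∷ c ∷ []) ⊆ w → PositiveBelow b c → PositiveInversion w
positiveInversion⁺ (_ ∷ʳ bc⊆w) p = inj₂ (positiveInversion⁺ bc⊆w p)
positiveInversion⁺ (refl ∷ c⊆w) p = inj₁ (Any.map (λ { refl → p }) (to∈ c⊆w))

positiveInversion⁻ : ∀ w → PositiveInversion w → ∃₂ λ b c → (b ∷ c ∷ []) ⊆ w × PositiveBelow b c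
positiveInversion⁻ (b ∷ w) (inj₁ below) with find below
... | c , c∈w , p = b , c , refl ∷ from∈ c∈w , p
positiveInversion⁻ (x ∷ w) (inj₂ inv) with positiveInversion⁻ w inv
... | b , c , bc⊆w , p = b , c , x ∷ʳ bc⊆w , p

≡-transfer : ∀ {x y x′ y′ : ℕ} → (x′ < y′ → x < y) → (y′ < x′ → y < x) → x ≡ y → x′ ≡ y′
≡-transfer {x′ = x′} {y′} lt gt refl with <-cmp x′ y′
... | tri< x′<y′ _ _ = contradiction (lt x′<y′) (<-irrefl refl)
... | tri≈ _ x′≡y′ _ = x′≡y′
... | tri> _ _ y′<x′ = contradiction (gt y′<x′) (<-irrefl refl)

orderIso-021 : ∀ {b c} → PositiveBelow b c → OrderIso (0 ∷ b ∷ c ∷ []) p021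
orderIso-021 {b} {c} (0<c , c<b) = refl , λ i j → <-agree i j , ≡-agree i j
  where
  u : List ℕ
  u = 0 ∷ b ∷ c ∷ []
  both : ∀ {A B : Set} → A → B → A ⇔ B
  both a b = mk⇔ (λ _ → b) (λ _ → a)
  neither : ∀ {A B : Set} → ¬ A → ¬ B → A ⇔ B
  neither ¬a ¬b = mk⇔ (⊥-elim ∘ ¬a) (⊥-elim ∘ ¬b)
  <-agree : (i j : Fin 3) → (lookup u i < lookup u j) ⇔ (lookup p021 (cast refl i) < lookup p021 (cast refl j))
  <-agree #0 #0 = neither (λ ()) (λ ())
  <-agree #0 (fsuc #0) = both (<-trans 0<c c<b) (s≤s z≤n)
  <-agree #0 (fsuc (fsuc #0)) = both 0<c (s≤s z≤n)
  <-agree (fsuc #0) #0 = neither (λ ()) (λ ())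
  <-agree (fsuc #0) (fsuc #0) = neither (<-irrefl refl) (<-irrefl refl)
  <-agree (fsuc #0) (fsuc (fsuc #0)) = neither (<-asym c<b) (<-asym (s≤s (s≤s z≤n)))
  <-agree (fsuc (fsuc #0)) #0 = neither (λ ()) (λ ())
  <-agree (fsuc (fsuc #0)) (fsuc #0) = both c<b (s≤s (s≤s z≤n))
  <-agree (fsuc (fsuc #0)) (fsuc (fsuc #0)) = neither (<-irrefl refl) (<-irrefl refl)
  ≡-agree : (i j : Fin 3) → (lookup u i ≡ lookup u j) ⇔ (lookup p021 (cast refl i) ≡ lookup p021 (cast refl j))
  ≡-agree i j = mk⇔ (≡-transfer (from (<-agree i j)) (from (<-agree j i)))
                    (≡-transfer (to (<-agree i j)) (to (<-agree j i)))
    where open Equivalence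

contains-021⇒positiveInversion : ∀ {w} → Contains w p021 → PositiveInversion w
contains-021⇒positiveInversion ((a ∷ b ∷ c ∷ []) , abc⊆w , refl , iso) =
  positiveInversion⁺ (∷ˡ⁻ abc⊆w) (<-≤-trans (s≤s z≤n) a<c , c<b)
  where
  a<c : a < c
  a<c = Equivalence.from (proj₁ (iso #0 (fsuc (fsuc #0)))) (s≤s z≤n)
  c<b : c < b
  c<b = Equivalence.from (proj₁ (iso (fsuc (fsuc #0)) (fsuc #0))) (s≤s (s≤s z≤n))
contains-021⇒positiveInversion ([] , _ , () , _)
contains-021⇒positiveInversion ((_ ∷ []) , _ , () , _)
contains-021⇒positiveInversion ((_ ∷ _ ∷ []) , _ , () , _)
contains-021⇒positiveInversion ((_ ∷ _ ∷ _ ∷ _ ∷ _) , _ , () , _)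

positiveInversion⇒contains-021 : ∀ w → PositiveInversion w → Contains (0 ∷ w) p021
positiveInversion⇒contains-021 w inv with positiveInversion⁻ w inv
... | b , c , bc⊆w , below = (0 ∷ b ∷ c ∷ []) , refl ∷ bc⊆w , orderIso-021 below

avoids-021⇔zeroOrRecord : ∀ w → Avoids (0 ∷ w) p021 ⇔ ZeroOrRecord 0 w
avoids-021⇔zeroOrRecord w = mk⇔
  (λ avoids → ¬positiveInversion⇒zeroOrRecord 0 w λ where
    (inj₁ below) → let _ , _ , _ , c<0 = find below in n≮0 c<0
    (inj₂ inv) → avoids (positiveInversion⇒contains-021 w inv))
  (λ zr → zeroOrRecord⇒¬positiveInversion 0 w zr ∘ contains-021⇒positiveInversion)

-- Generating the avoiding words letter by letter

m<n∸o⇒m+o<n : ∀ {m n o} → m < n ∸ o → m + o < n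
m<n∸o⇒m+o<n {m} {n} {o} m<n∸o = subst (m + o <_) (m∸n+n≡m (<⇒≤ o<n)) (+-monoˡ-< o m<n∸o)
  where
  o<n : o < n
  o<n = m∸n≢0⇒n<m (λ n∸o≡0 → n≮0 (subst (m <_) n∸o≡0 m<n∸o))

-- Starting the interval at m ⊔ 1 rather than m keeps 0 from being listed twice.
nextLetters : ℕ → ℕ → List ℕ
nextLetters l m = 0 ∷ applyUpTo (_+ (m ⊔ 1)) (2 + l ∸ (m ⊔ 1))

∈-nextLetters⁻ : ∀ {l m y} → y ∈ nextLetters l m → y ≤ suc l × (y ≡ 0 ⊎ m ≤ y)
∈-nextLetters⁻ (here refl) = z≤n , inj₁ refl
∈-nextLetters⁻ {l} {m} (there y∈) with ∈-applyUpTo⁻ (_+ (m ⊔ 1)) y∈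
... | i , i<k , refl = ≤-pred (m<n∸o⇒m+o<n i<k) , inj₂ (≤-trans (m≤m⊔n m 1) (m≤n+m (m ⊔ 1) i))

∈-nextLetters⁺ : ∀ {l m y} → y ≤ suc l → y ≡ 0 ⊎ m ≤ y → y ∈ nextLetters l m
∈-nextLetters⁺ {y = zero} _ _ = here refl
∈-nextLetters⁺ {l} {m} {suc y} y≤1+l (inj₂ m≤y) =
  there (subst (_∈ applyUpTo (_+ (m ⊔ 1)) (2 + l ∸ (m ⊔ 1))) (m∸n+n≡m b≤y)
               (∈-applyUpTo⁺ (_+ (m ⊔ 1)) (∸-monoˡ-< (s≤s y≤1+l) b≤y)))
  where
  b≤y : m ⊔ 1 ≤ suc y
  b≤y = ⊔-lub m≤y (s≤s z≤n)

nextLetters-unique : ∀ l m → Unique (nextLetters l m)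
nextLetters-unique l m =
  All.tabulate 0∉ ∷ Unique.applyUpTo⁺₁ (_+ (m ⊔ 1)) _ (λ i<j _ → <⇒≢ i<j ∘ +-cancelʳ-≡ (m ⊔ 1) _ _)
  where
  0∉ : ∀ {y} → y ∈ applyUpTo (_+ (m ⊔ 1)) (2 + l ∸ (m ⊔ 1)) → 0 ≢ y
  0∉ y∈ with ∈-applyUpTo⁻ (_+ (m ⊔ 1)) y∈
  ... | i , _ , refl = <⇒≢ (<-≤-trans (m≤n⊔m m 1) (m≤n+m (m ⊔ 1) i))

prefixEach : {A : Set} → (A → List (List A)) → List A → List (List A)
prefixEach G = concatMap (λ y → map (y ∷_) (G y))

module _ {A : Set} {G : A → List (List A)} where

  ∈-prefixEach⁻ : ∀ ys {w} → w ∈ prefixEach G ys → ∃₂ λ y r → y ∈ ys × r ∈ G y × w ≡ y ∷ r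
  ∈-prefixEach⁻ ys w∈ with find (∈-concatMap⁻ (λ y → map (y ∷_) (G y)) {xs = ys} w∈)
  ... | y , y∈ys , w∈yG with ∈-map⁻ (y ∷_) w∈yG
  ... | r , r∈Gy , w≡y∷r = y , r , y∈ys , r∈Gy , w≡y∷r

  ∈-prefixEach⁺ : ∀ {ys y r} → y ∈ ys → r ∈ G y → (y ∷ r) ∈ prefixEach G ys
  ∈-prefixEach⁺ y∈ys r∈Gy = ∈-concatMap⁺ (λ y → map (y ∷_) (G y)) (lose y∈ys (∈-map⁺ (_ ∷_) r∈Gy))

  prefixEach-unique : ∀ {ys} → Unique ys → (∀ y → Unique (G y)) → Unique (prefixEach G ys)
  prefixEach-unique [] _ = []
  prefixEach-unique {y ∷ ys} (y∉ys ∷ ys!) G! =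
    Unique.++⁺ (Unique.map⁺ ∷-injectiveʳ (G! y)) (prefixEach-unique ys! G!) disjoint
    where
    disjoint : Disjoint (map (y ∷_) (G y)) (prefixEach G ys)
    disjoint (v∈yG , v∈rest) with ∈-map⁻ (y ∷_) v∈yG | ∈-prefixEach⁻ ys v∈rest
    ... | _ , _ , refl | _ , _ , y∈ys , _ , refl = All¬⇒¬Any y∉ys y∈ys

  length-prefixEach : ∀ ys → length (prefixEach G ys) ≡ sum (map (length ∘ G) ys)
  length-prefixEach [] = refl
  length-prefixEach (y ∷ ys) = begin
    length (map (y ∷_) (G y) ++ prefixEach G ys)
      ≡⟨ length-++ (map (y ∷_) (G y)) ⟩
    length (map (y ∷_) (G y)) + length (prefixEach G ys)
      ≡⟨ cong₂ _+_ (length-map (y ∷_) (G y)) (length-prefixEach ys) ⟩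
    length (G y) + sum (map (length ∘ G) ys) ∎
    where open ≡-Reasoning

-- Counting words and descents

descent : ℕ → ℕ → ℕ
descent x y = if y <ᵇ x then 1 else 0

descent-≤ : ∀ {x y} → x ≤ y → descent x y ≡ 0
descent-≤ {x} {y} x≤y with y <ᵇ x in eq
... | true = contradiction (<ᵇ⇒< y x (subst T (sym eq) tt)) (≤⇒≯ x≤y)
... | false = refl

descentsAfter : ℕ → List (List ℕ) → ℕ
descentsAfter l G = sum (map (des ∘ (l ∷_)) G)

descentsAfter-++ : ∀ l G H → descentsAfter l (G ++ H) ≡ descentsAfter l G + descentsAfter l H
descentsAfter-++ l G H = trans (cong sum (map-++ (des ∘ (l ∷_)) G H)) (sum-++ (map (des ∘ (l ∷_)) G) _)

descentsAfter-map-∷ : ∀ l y G → descentsAfter l (map (y ∷_) G) ≡ descent l y * length G + descentsAfter y G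
descentsAfter-map-∷ l y [] = cong (_+ 0) (sym (*-zeroʳ (descent l y)))
descentsAfter-map-∷ l y (r ∷ G) = begin
  descent l y + des (y ∷ r) + descentsAfter l (map (y ∷_) G)
    ≡⟨ cong (λ t → descent l y + des (y ∷ r) + t) (descentsAfter-map-∷ l y G) ⟩
  descent l y + des (y ∷ r) + (descent l y * length G + descentsAfter y G)
    ≡⟨ regroup (descent l y) (des (y ∷ r)) (length G) (descentsAfter y G) ⟩
  descent l y * suc (length G) + (des (y ∷ r) + descentsAfter y G) ∎
  where
  open ≡-Reasoning
  regroup : ∀ d e g f → d + e + (d * g + f) ≡ d * suc g + (e + f)
  regroup = solve-∀

descentsAfter-prefixEach : ∀ l (G : ℕ → List (List ℕ)) ys →
  descentsAfter l (prefixEach G ys) ≡ sum (map (λ y → descent l y * length (G y) + descentsAfter y (G y)) ys)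
descentsAfter-prefixEach l G [] = refl
descentsAfter-prefixEach l G (y ∷ ys) =
  trans (descentsAfter-++ l (map (y ∷_) (G y)) (prefixEach G ys))
        (cong₂ _+_ (descentsAfter-map-∷ l y (G y)) (descentsAfter-prefixEach l G ys))

words : ℕ → ℕ → ℕ → List (List ℕ)
words zero l m = [] ∷ []
words (suc n) l m = prefixEach (λ y → words n y (m ⊔ y)) (nextLetters l m)

∈-words⁻ : ∀ n l m {w} → w ∈ words n l m → length w ≡ n × StepsFrom l w × ZeroOrRecord m w
∈-words⁻ zero l m (here refl) = refl , tt , tt
∈-words⁻ (suc n) l m w∈ with ∈-prefixEach⁻ (nextLetters l m) w∈
... | y , r , y∈ , r∈ , refl with ∈-nextLetters⁻ y∈ | ∈-words⁻ n y (m ⊔ y) r∈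
... | y≤1+l , zeroOrAtLeast | length≡n , steps , records =
  cong suc length≡n , (y≤1+l , steps) , (zeroOrAtLeast , records)

∈-words⁺ : ∀ n l m {w} → length w ≡ n → StepsFrom l w → ZeroOrRecord m w → w ∈ words n l m
∈-words⁺ zero l m {[]} _ _ _ = here refl
∈-words⁺ (suc n) l m {y ∷ r} length≡ (y≤1+l , steps) (zeroOrAtLeast , records) =
  ∈-prefixEach⁺ (∈-nextLetters⁺ y≤1+l zeroOrAtLeast) (∈-words⁺ n y (m ⊔ y) (suc-injective length≡) steps records)

words-unique : ∀ n l m → Unique (words n l m)
words-unique zero l m = [] ∷ []
words-unique (suc n) l m = prefixEach-unique (nextLetters-unique l m) (λ y → words-unique n y (m ⊔ y))

words-00≡01 : ∀ n → words n 0 0 ≡ words n 0 1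
words-00≡01 zero = refl
words-00≡01 (suc n) = cong (λ G → map (0 ∷_) G ++ map (1 ∷_) (words n 1 1) ++ []) (words-00≡01 n)

count : ℕ → ℕ → ℕ → ℕ
count n l m = length (words n l m)

descents : ℕ → ℕ → ℕ → ℕ
descents n l m = descentsAfter l (words n l m)

count-suc : ∀ n l m → count (suc n) l m ≡ sum (map (λ y → count n y (m ⊔ y)) (nextLetters l m))
count-suc n l m = length-prefixEach {G = λ y → words n y (m ⊔ y)} (nextLetters l m)

descentsBranch : ℕ → ℕ → ℕ → ℕ → ℕ
descentsBranch n l y m = descent l y * count n y m + descents n y m

descents-suc : ∀ n l m → descents (suc n) l m ≡ sum (map (λ y → descentsBranch n l y (m ⊔ y)) (nextLetters l m))
descents-suc n l m = descentsAfter-prefixEach l (λ y → words n y (m ⊔ y)) (nextLetters l m)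

sum-nextLetters-floor : ∀ k (f : ℕ → ℕ → ℕ) →
  sum (map (λ y → f y ((2 + k) ⊔ y)) (nextLetters 0 (2 + k))) ≡ f 0 (2 + k) + 0
sum-nextLetters-floor k f rewrite 0∸n≡0 k = refl

sum-nextLetters-top : ∀ k (f : ℕ → ℕ → ℕ) →
  sum (map (λ y → f y ((2 + k) ⊔ y)) (nextLetters (2 + k) (2 + k)))
    ≡ f 0 (2 + k) + (f (2 + k) (2 + k) + (f (3 + k) (3 + k) + 0))
sum-nextLetters-top k f rewrite m+n∸n≡m 2 k | ⊔-idem k | m≤n⇒m⊔n≡n (n≤1+n k) = refl

count-floor : ∀ n k → count n 0 (2 + k) ≡ 1
count-floor zero k = refl
count-floor (suc n) k =
  trans (count-suc n 0 (2 + k)) (trans (sum-nextLetters-floor k (count n)) (cong (_+ 0) (count-floor n k)))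

descents-floor : ∀ n k → descents n 0 (2 + k) ≡ 0
descents-floor zero k = refl
descents-floor (suc n) k =
  trans (descents-suc n 0 (2 + k)) (trans (sum-nextLetters-floor k (descentsBranch n 0)) (cong (_+ 0) (descents-floor n k)))

count-top : ∀ n k → suc (count n (2 + k) (2 + k)) ≡ 2 ^ suc n
count-top zero k = refl
count-top (suc n) k = begin
  suc (count (suc n) (2 + k) (2 + k))
    ≡⟨ cong suc (trans (count-suc n (2 + k) (2 + k)) (sum-nextLetters-top k (count n))) ⟩
  suc (count n 0 (2 + k) + (t + (t′ + 0)))
    ≡⟨ cong (λ c → suc (c + (t + (t′ + 0)))) (count-floor n k) ⟩
  suc (1 + (t + (t′ + 0)))
    ≡⟨ regroup t t′ ⟩
  suc t + (suc t′ + 0)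
    ≡⟨ cong₂ (λ x y → x + (y + 0)) (count-top n k) (count-top n (suc k)) ⟩
  2 ^ suc (suc n) ∎
  where
  open ≡-Reasoning
  t t′ : ℕ
  t = count n (2 + k) (2 + k)
  t′ = count n (3 + k) (3 + k)
  regroup : ∀ x y → suc (1 + (x + (y + 0))) ≡ suc x + (suc y + 0)
  regroup = solve-∀

descents-top : ∀ n k → suc (descents n (2 + k) (2 + k)) ≡ 2 ^ n
descents-top zero k = refl
descents-top (suc n) k = begin
  suc (descents (suc n) (2 + k) (2 + k))
    ≡⟨ cong suc (trans (descents-suc n (2 + k) (2 + k)) (sum-nextLetters-top k (descentsBranch n (2 + k)))) ⟩
  suc (1 * count n 0 (2 + k) + descents n 0 (2 + k) +
         (descent (2 + k) (2 + k) * t + d + (descent (2 + k) (3 + k) * t′ + d′ + 0)))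
    ≡⟨ cong₂ (λ x y → suc (1 * count n 0 (2 + k) + descents n 0 (2 + k) + (x * t + d + (y * t′ + d′ + 0))))
             (descent-≤ (≤-refl {2 + k})) (descent-≤ (n≤1+n (2 + k))) ⟩
  suc (1 * count n 0 (2 + k) + descents n 0 (2 + k) + (d + (d′ + 0)))
    ≡⟨ cong₂ (λ x y → suc (1 * x + y + (d + (d′ + 0)))) (count-floor n k) (descents-floor n k) ⟩
  suc (1 + (d + (d′ + 0)))
    ≡⟨ regroup d d′ ⟩
  suc d + (suc d′ + 0)
    ≡⟨ cong₂ (λ x y → x + (y + 0)) (descents-top n k) (descents-top n (suc k)) ⟩
  2 ^ suc n ∎
  where
  open ≡-Reasoning
  t t′ d d′ : ℕ
  t = count n (2 + k) (2 + k)
  t′ = count n (3 + k) (3 + k)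
  d = descents n (2 + k) (2 + k)
  d′ = descents n (3 + k) (3 + k)
  regroup : ∀ x y → suc (1 + (x + (y + 0))) ≡ suc x + (suc y + 0)
  regroup = solve-∀

count-low : ∀ n → (2 * count n 0 1 ≡ n * 2 ^ n + 2) × (2 * count n 1 1 ≡ (n + 2) * 2 ^ n)
count-low zero = refl , refl
count-low (suc n) = step-01 , step-11
  where
  open ≡-Reasoning
  a c u P : ℕ
  a = count n 0 1
  c = count n 1 1
  u = count n 2 2
  P = 2 ^ n
  step-01 : 2 * count (suc n) 0 1 ≡ suc n * 2 ^ suc n + 2
  step-01 = begin
    2 * count (suc n) 0 1       ≡⟨ cong (2 *_) (count-suc n 0 1) ⟩
    2 * (a + (c + 0))           ≡⟨ regroup a c ⟩
    2 * a + 2 * c               ≡⟨ cong₂ _+_ (proj₁ (count-low n)) (proj₂ (count-low n)) ⟩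
    (n * P + 2) + (n + 2) * P   ≡⟨ close n P ⟩
    suc n * (2 * P) + 2         ∎
    where
    regroup : ∀ a c → 2 * (a + (c + 0)) ≡ 2 * a + 2 * c
    regroup = solve-∀
    close : ∀ n P → (n * P + 2) + (n + 2) * P ≡ suc n * (2 * P) + 2
    close = solve-∀
  step-11 : 2 * count (suc n) 1 1 ≡ (suc n + 2) * 2 ^ suc n
  step-11 = +-cancelˡ-≡ 2 _ _ (begin
    2 + 2 * count (suc n) 1 1          ≡⟨ cong (λ x → 2 + 2 * x) (count-suc n 1 1) ⟩
    2 + 2 * (a + (c + (u + 0)))        ≡⟨ regroup a c u ⟩
    2 * a + 2 * c + 2 * suc u          ≡⟨ cong₂ _+_ (cong₂ _+_ (proj₁ (count-low n)) (proj₂ (count-low n)))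
                                                    (cong (2 *_) (count-top n 0)) ⟩
    (n * P + 2) + (n + 2) * P + 2 * (2 * P) ≡⟨ close n P ⟩
    2 + (suc n + 2) * (2 * P)          ∎)
    where
    regroup : ∀ a c u → 2 + 2 * (a + (c + (u + 0))) ≡ 2 * a + 2 * c + 2 * suc u
    regroup = solve-∀
    close : ∀ n P → (n * P + 2) + (n + 2) * P + 2 * (2 * P) ≡ 2 + (suc n + 2) * (2 * P)
    close = solve-∀

descents-low : ∀ n → (8 * descents (suc n) 0 1 ≡ (n + 3) * n * 2 ^ n)
                   × (8 * descents (suc n) 1 1 ≡ (n * n + 7 * n + 8) * 2 ^ n)
descents-low zero = refl , refl
descents-low (suc n) = step-01 , step-11
  where
  open ≡-Reasoning
  a da dc du P : ℕ
  a = count (suc n) 0 1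
  da = descents (suc n) 0 1
  dc = descents (suc n) 1 1
  du = descents (suc n) 2 2
  P = 2 ^ n
  step-01 : 8 * descents (suc (suc n)) 0 1 ≡ (suc n + 3) * suc n * 2 ^ suc n
  step-01 = begin
    8 * descents (suc (suc n)) 0 1           ≡⟨ cong (8 *_) (descents-suc (suc n) 0 1) ⟩
    8 * (da + (dc + 0))                      ≡⟨ regroup da dc ⟩
    8 * da + 8 * dc                          ≡⟨ cong₂ _+_ (proj₁ (descents-low n)) (proj₂ (descents-low n)) ⟩
    (n + 3) * n * P + (n * n + 7 * n + 8) * P ≡⟨ close n P ⟩
    (suc n + 3) * suc n * (2 * P)            ∎
    where
    regroup : ∀ a c → 8 * (a + (c + 0)) ≡ 8 * a + 8 * c
    regroup = solve-∀
    close : ∀ n P → (n + 3) * n * P + (n * n + 7 * n + 8) * P ≡ (suc n + 3) * suc n * (2 * P)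
    close = solve-∀
  step-11 : 8 * descents (suc (suc n)) 1 1 ≡ (suc n * suc n + 7 * suc n + 8) * 2 ^ suc n
  step-11 = +-cancelˡ-≡ 8 _ _ (begin
    8 + 8 * descents (suc (suc n)) 1 1       ≡⟨ cong (λ x → 8 + 8 * x) (descents-suc (suc n) 1 1) ⟩
    8 + 8 * (a + 0 + da + (dc + (du + 0)))   ≡⟨ regroup a da dc du ⟩
    4 * (2 * a) + 8 * da + 8 * dc + 8 * suc du
      ≡⟨ cong₂ _+_ (cong₂ _+_ (cong₂ _+_ (cong (4 *_) (proj₁ (count-low (suc n))))
                                          (proj₁ (descents-low n)))
                               (proj₂ (descents-low n)))
                    (cong (8 *_) (descents-top (suc n) 0)) ⟩
    4 * (suc n * (2 * P) + 2) + (n + 3) * n * P + (n * n + 7 * n + 8) * P + 8 * (2 * P)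
      ≡⟨ close n P ⟩
    8 + (suc n * suc n + 7 * suc n + 8) * (2 * P) ∎)
    where
    regroup : ∀ a da dc du → 8 + 8 * (a + 0 + da + (dc + (du + 0))) ≡ 4 * (2 * a) + 8 * da + 8 * dc + 8 * suc du
    regroup = solve-∀
    close : ∀ n P → 4 * (suc n * (2 * P) + 2) + (n + 3) * n * P + (n * n + 7 * n + 8) * P + 8 * (2 * P)
                    ≡ 8 + (suc n * suc n + 7 * suc n + 8) * (2 * P)
    close = solve-∀

-- The words of 𝒞ₙ(021)

catalan021 : ℕ → List (List ℕ)
catalan021 zero = [] ∷ []
catalan021 (suc n) = map (0 ∷_) (words n 0 0)

catalan021-enumerates : ∀ n → Enumerates p021 n (catalan021 n)
catalan021-enumerates zero = ([] ∷ []) , λ w → mk⇔ (sound w) (complete w)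
  where
  sound : ∀ w → w ∈ catalan021 zero → CatalanWord zero w × Avoids w p021
  sound .[] (here refl) = (refl , tt) , contains-021⇒positiveInversion
  complete : ∀ w → CatalanWord zero w × Avoids w p021 → w ∈ catalan021 zero
  complete [] _ = here refl
catalan021-enumerates (suc n) =
  Unique.map⁺ ∷-injectiveʳ (words-unique n 0 0) , λ w → mk⇔ (sound w) (complete w)
  where
  sound : ∀ w → w ∈ catalan021 (suc n) → CatalanWord (suc n) w × Avoids w p021
  sound w w∈ with ∈-map⁻ (0 ∷_) w∈
  ... | r , r∈ , refl with ∈-words⁻ n 0 0 r∈
  ... | length≡n , steps , records =
    (cong suc length≡n , refl , steps) , Equivalence.from (avoids-021⇔zeroOrRecord r) records
  complete : ∀ w → CatalanWord (suc n) w × Avoids w p021 → w ∈ catalan021 (suc n)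
  complete (_ ∷ r) ((length≡ , refl , steps) , avoids) =
    ∈-map⁺ (0 ∷_) (∈-words⁺ n 0 0 (suc-injective length≡) steps
                             (Equivalence.to (avoids-021⇔zeroOrRecord r) avoids))

enumerations-↭ : ∀ {p n L L′} → Enumerates p n L → Enumerates p n L′ → L ↭ L′
enumerations-↭ (L! , L⇔) (L′! , L′⇔) =
  ∼bag⇒↭ (unique∧set⇒bag L! L′! λ {w} → ⇔.trans (L⇔ w) (⇔.sym (L′⇔ w)))

length-catalan021 : ∀ n → length (catalan021 (suc n)) ≡ count n 0 1
length-catalan021 n = trans (length-map (0 ∷_) (words n 0 0)) (cong length (words-00≡01 n))

descents-catalan021 : ∀ n → sum (map des (catalan021 (suc n))) ≡ descents n 0 1
descents-catalan021 n = trans (cong sum (sym (map-∘ (words n 0 0)))) (cong (descentsAfter 0) (words-00≡01 n))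

twice-length-catalan021 : ∀ n → 2 * length (catalan021 (suc n)) ≡ n * 2 ^ n + 2
twice-length-catalan021 n = trans (cong (2 *_) (length-catalan021 n)) (proj₁ (count-low n))

eight-descents-catalan021 : ∀ n → 8 * sum (map des (catalan021 (2 + n))) ≡ (n + 3) * n * 2 ^ n
eight-descents-catalan021 n = trans (cong (8 *_) (descents-catalan021 (suc n))) (proj₁ (descents-low n))

catalan021-card : (n : ℕ) → 1 ≤ n → (L : List (List ℕ)) → Enumerates p021 n L →
  length L ≡ (n ∸ 1) * 2 ^ (n ∸ 2) + 1
catalan021-card (suc n) _ L enum = begin
  length L                    ≡⟨ ↭-length (enumerations-↭ enum (catalan021-enumerates (suc n))) ⟩
  length (catalan021 (suc n)) ≡⟨ halve n (twice-length-catalan021 n) ⟩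
  n * 2 ^ (n ∸ 1) + 1         ∎
  where
  open ≡-Reasoning
  halve : ∀ n {x} → 2 * x ≡ n * 2 ^ n + 2 → x ≡ n * 2 ^ (n ∸ 1) + 1
  halve zero {x} 2x≡2 = *-cancelˡ-≡ x 1 2 2x≡2
  halve (suc n) {x} 2x≡ = *-cancelˡ-≡ x _ 2 (trans 2x≡ (double (suc n) (2 ^ n)))
    where
    double : ∀ m P → m * (2 * P) + 2 ≡ 2 * (m * P + 1)
    double = solve-∀

catalan021-descents : (n : ℕ) → 2 ≤ n → (L : List (List ℕ)) → Enumerates p021 n L →
  32 * sum (map des L) ≡ (n + 1) * (n ∸ 2) * 2 ^ n
catalan021-descents (suc zero) (s≤s ()) _ _
catalan021-descents (suc (suc n)) _ L enum = begin
  32 * sum (map des L)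
    ≡⟨ cong (32 *_) (sum-↭ (map⁺ des (enumerations-↭ enum (catalan021-enumerates (2 + n))))) ⟩
  32 * sum (map des (catalan021 (2 + n)))
    ≡⟨ *-assoc 4 8 (sum (map des (catalan021 (2 + n)))) ⟩
  4 * (8 * sum (map des (catalan021 (2 + n))))
    ≡⟨ cong (4 *_) (eight-descents-catalan021 n) ⟩
  4 * ((n + 3) * n * 2 ^ n)
    ≡⟨ quadruple n (2 ^ n) ⟩
  (2 + n + 1) * n * 2 ^ (2 + n) ∎
  where
  open ≡-Reasoning
  quadruple : ∀ n P → 4 * ((n + 3) * n * P) ≡ (2 + n + 1) * n * (2 * (2 * P))
  quadruple = solve-∀

-- Generating functions

mulPS-cong : ∀ p {f g : ℕ → ℤ} → (∀ k → f k ≡ g k) → ∀ n → mulPS p f n ≡ mulPS p g n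
mulPS-cong [] f≗g n = refl
mulPS-cong (c ∷ cs) f≗g zero = cong (c ℤ.*_) (f≗g zero)
mulPS-cong (c ∷ cs) f≗g (suc n) = cong₂ ℤ._+_ (cong (c ℤ.*_) (f≗g (suc n))) (mulPS-cong cs f≗g n)

-- The shape of a coefficient of mulPS by the cubic 1 - b x + c x² - d x³.
signed-combination≡0 : ∀ b c d x y z w → x + c * z ≡ b * y + d * w →
  + 1 ℤ.* + x ℤ.+ ((ℤ.- (+ b)) ℤ.* + y ℤ.+ (+ c ℤ.* + z ℤ.+ ((ℤ.- (+ d)) ℤ.* + w ℤ.+ + 0))) ≡ + 0
signed-combination≡0 b c d x y z w eq = begin
  + 1 ℤ.* + x ℤ.+ ((ℤ.- (+ b)) ℤ.* + y ℤ.+ (+ c ℤ.* + z ℤ.+ ((ℤ.- (+ d)) ℤ.* + w ℤ.+ + 0)))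
    ≡⟨ rearrange (+ b) (+ c) (+ d) (+ x) (+ y) (+ z) (+ w) ⟩
  (+ x ℤ.+ + c ℤ.* + z) ℤ.- (+ b ℤ.* + y ℤ.+ + d ℤ.* + w)
    ≡⟨ cong₂ ℤ._-_ (sym (trans (pos-+ x (c * z)) (cong (ℤ._+_ (+ x)) (pos-* c z))))
                   (sym (trans (pos-+ (b * y) (d * w)) (cong₂ ℤ._+_ (pos-* b y) (pos-* d w)))) ⟩
  + (x + c * z) ℤ.- + (b * y + d * w)
    ≡⟨ cong (λ t → + t ℤ.- + (b * y + d * w)) eq ⟩
  + (b * y + d * w) ℤ.- + (b * y + d * w)
    ≡⟨ +-inverseʳ (+ (b * y + d * w)) ⟩
  + 0 ∎
  where
  open ≡-Reasoning
  rearrange : ∀ B C D X Y Z W →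
    + 1 ℤ.* X ℤ.+ ((ℤ.- B) ℤ.* Y ℤ.+ (C ℤ.* Z ℤ.+ ((ℤ.- D) ℤ.* W ℤ.+ + 0)))
      ≡ (X ℤ.+ C ℤ.* Z) ℤ.- (B ℤ.* Y ℤ.+ D ℤ.* W)
  rearrange = ℤ-Solver.solve-∀

recurrence-[1-2x]²[1-x] : (x : ℕ → ℕ) → (∀ n → 2 * x n ≡ n * 2 ^ n + 2) →
  ∀ j → x (3 + j) + 8 * x (1 + j) ≡ 5 * x (2 + j) + 4 * x j
recurrence-[1-2x]²[1-x] x closed j = *-cancelˡ-≡ _ _ 2 (begin
  2 * (x (3 + j) + 8 * x (1 + j))           ≡⟨ distrib (x (3 + j)) (x (1 + j)) ⟩
  2 * x (3 + j) + 8 * (2 * x (1 + j))       ≡⟨ cong₂ (λ p q → p + 8 * q) (closed (3 + j)) (closed (1 + j)) ⟩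
  (3 + j) * 2 ^ (3 + j) + 2 + 8 * ((1 + j) * 2 ^ (1 + j) + 2)
                                            ≡⟨ identity j (2 ^ j) ⟩
  5 * ((2 + j) * 2 ^ (2 + j) + 2) + 4 * (j * 2 ^ j + 2)
                                            ≡⟨ cong₂ (λ p q → 5 * p + 4 * q) (sym (closed (2 + j))) (sym (closed j)) ⟩
  5 * (2 * x (2 + j)) + 4 * (2 * x j)       ≡⟨ collect (x (2 + j)) (x j) ⟩
  2 * (5 * x (2 + j) + 4 * x j)             ∎)
  where
  open ≡-Reasoning
  distrib : ∀ a b → 2 * (a + 8 * b) ≡ 2 * a + 8 * (2 * b)
  distrib = solve-∀
  identity : ∀ j P → (3 + j) * (2 * (2 * (2 * P))) + 2 + 8 * ((1 + j) * (2 * P) + 2)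
                   ≡ 5 * ((2 + j) * (2 * (2 * P)) + 2) + 4 * (j * P + 2)
  identity = solve-∀
  collect : ∀ a b → 5 * (2 * a) + 4 * (2 * b) ≡ 2 * (5 * a + 4 * b)
  collect = solve-∀

recurrence-[1-2x]³ : (y : ℕ → ℕ) → (∀ n → 8 * y (suc n) ≡ (n + 3) * n * 2 ^ n) →
  ∀ j → y (4 + j) + 12 * y (2 + j) ≡ 6 * y (3 + j) + 8 * y (1 + j)
recurrence-[1-2x]³ y closed j = *-cancelˡ-≡ _ _ 8 (begin
  8 * (y (4 + j) + 12 * y (2 + j))          ≡⟨ distrib (y (4 + j)) (y (2 + j)) ⟩
  8 * y (4 + j) + 12 * (8 * y (2 + j))      ≡⟨ cong₂ (λ p q → p + 12 * q) (closed (3 + j)) (closed (1 + j)) ⟩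
  (3 + j + 3) * (3 + j) * 2 ^ (3 + j) + 12 * ((1 + j + 3) * (1 + j) * 2 ^ (1 + j))
                                            ≡⟨ identity j (2 ^ j) ⟩
  6 * ((2 + j + 3) * (2 + j) * 2 ^ (2 + j)) + 8 * ((j + 3) * j * 2 ^ j)
                                            ≡⟨ cong₂ (λ p q → 6 * p + 8 * q) (sym (closed (2 + j))) (sym (closed j)) ⟩
  6 * (8 * y (3 + j)) + 8 * (8 * y (1 + j)) ≡⟨ collect (y (3 + j)) (y (1 + j)) ⟩
  8 * (6 * y (3 + j) + 8 * y (1 + j))       ∎)
  where
  open ≡-Reasoning
  distrib : ∀ a b → 8 * (a + 12 * b) ≡ 8 * a + 12 * (8 * b)
  distrib = solve-∀
  identity : ∀ j P → (3 + j + 3) * (3 + j) * (2 * (2 * (2 * P))) + 12 * ((1 + j + 3) * (1 + j) * (2 * P))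
                   ≡ 6 * ((2 + j + 3) * (2 + j) * (2 * (2 * P))) + 8 * ((j + 3) * j * P)
  identity = solve-∀
  collect : ∀ a b → 6 * (8 * a) + 8 * (8 * b) ≡ 8 * (6 * a + 8 * b)
  collect = solve-∀

count-series : ∀ n → mulPS (polyMul one-2x (polyMul one-2x one-x)) (λ k → + (length (catalan021 k))) n
                     ≡ polyCoeff (+ 1 ∷ ℤ.- (+ 4) ∷ + 5 ∷ ℤ.- (+ 1) ∷ []) n
count-series 0 = refl
count-series 1 = refl
count-series 2 = refl
count-series 3 = refl
count-series (suc (suc (suc (suc j)))) =
  signed-combination≡0 5 8 4 (a (3 + j)) (a (2 + j)) (a (1 + j)) (a j)
    (recurrence-[1-2x]²[1-x] a twice-length-catalan021 j)
  where
  a : ℕ → ℕ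
  a m = length (catalan021 (suc m))

descents-series : ∀ n → mulPS (polyMul one-2x (polyMul one-2x one-2x)) (λ k → + (sum (map des (catalan021 k)))) n
                        ≡ polyCoeff (+ 0 ∷ + 0 ∷ + 0 ∷ + 1 ∷ ℤ.- (+ 1) ∷ []) n
descents-series 0 = refl
descents-series 1 = refl
descents-series 2 = refl
descents-series 3 = refl
descents-series 4 = refl
descents-series (suc (suc (suc (suc (suc j))))) =
  signed-combination≡0 6 12 8 (s (4 + j)) (s (3 + j)) (s (2 + j)) (s (1 + j))
    (recurrence-[1-2x]³ s eight-descents-catalan021 j)
  where
  s : ℕ → ℕ
  s m = sum (map des (catalan021 (suc m)))

corollary4 :
    ((n : ℕ) → ∃ λ L → Enumerates p021 n L)
    × ((n : ℕ) → 1 ≤ n → (L : List (List ℕ)) → Enumerates p021 n L →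
        length L ≡ (n ∸ 1) * 2 ^ (n ∸ 2) + 1)
    × ((n : ℕ) → 2 ≤ n → (L : List (List ℕ)) → Enumerates p021 n L →
        32 * sum (map des L) ≡ (n + 1) * (n ∸ 2) * 2 ^ n)
    × ((a : ℕ → ℕ) → ((n : ℕ) → (L : List (List ℕ)) → Enumerates p021 n L → length L ≡ a n) →
        (n : ℕ) → mulPS (polyMul one-2x (polyMul one-2x one-x)) (λ k → + (a k)) n
          ≡ polyCoeff (+ 1 ∷ ℤ.- (+ 4) ∷ + 5 ∷ ℤ.- (+ 1) ∷ []) n)
    × ((s : ℕ → ℕ) → ((n : ℕ) → (L : List (List ℕ)) → Enumerates p021 n L → sum (map des L) ≡ s n) →
        (n : ℕ) → mulPS (polyMul one-2x (polyMul one-2x one-2x)) (λ k → + (s k)) n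
          ≡ polyCoeff (+ 0 ∷ + 0 ∷ + 0 ∷ + 1 ∷ ℤ.- (+ 1) ∷ []) n)
corollary4 =
  (λ n → catalan021 n , catalan021-enumerates n) ,
  catalan021-card ,
  catalan021-descents ,
  (λ a a≡ n → trans (mulPS-cong (polyMul one-2x (polyMul one-2x one-x)) (λ k → sym (cong +_ (a≡ k _ (catalan021-enumerates k)))) n) (count-series n)) ,
  (λ s s≡ n → trans (mulPS-cong (polyMul one-2x (polyMul one-2x one-2x)) (λ k → sym (cong +_ (s≡ k _ (catalan021-enumerates k)))) n) (descents-series n))
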